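{- Let $G$ be a connected graph with root $r$, let $S\subseteq V(G)$ be a cut set of $G$, and let $G_0,G_1,\dots,G_k$ be the components of $G-S$ with $r\in V(G_0)$. If for every $v\in S$ we have $|N(v)-(V(G_0)\cup S)|\ge 2$, and for every $x\in N(S)-(V(G_0)\cup S)$ we have $|N(x)-S|\ge 2$, then $\eta(G,r)=\infty$.
   Context: All graphs are finite, simple and connected. $N(v)$ is the open neighborhood of $v$ and $N(S)=\bigcup_{v\in S}N(v)$. A configuration $C$ on $G$ is a function $C:V(G)\to\mathbb{Z}_{\ge 0}$; its size is $\sum_v C(v)$. A pebbling move removes two pebbles from a vertex and places one pebble on an adjacent vertex. The Two-Player Pebbling Game on $G$ with root $r$ and starting configuration $C$ is played by Mover and Defender in rounds: in each round Mover makes a pebbling move and then Defender makes a pebbling move; each player must take their turn. If Mover pebbles from $u$ to $v$, Defender may not pebble from $v$ to $u$ in the same round. Mover wins if at any time the root has at least one pebble; Defender wins if the root has no pebble and there are no more pebbling moves. A winning strategy is a rule choosing a player's moves as a function of the current position which guarantees that player wins. $\eta(G,r)$ is the minimum $m$ such that for every configuration of $m$ pebbles Mover has a winning strategy; if for arbitrarily large $m$ there is a configuration of size greater than $m$ on which Defender has a winning strategy, then $\eta(G,r)=\infty$. -}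

module Defs where

open import Data.Nat using (ℕ; zero; suc; _∸_; _≤_; _<_)
open import Data.Fin using (Fin)
open import Data.Fin.Properties using (_≟_)
open import Data.Bool using (Bool; true; false)
open import Data.List using (map; allFin)
open import Data.Nat.ListAction using (sum)
open import Data.Product using (Σ; _×_; _,_; ∃)
open import Data.Sum using (_⊎_)
open import Data.Unit using (⊤)
open import Relation.Nullary using (¬_; yes; no)
open import Relation.Binary.PropositionalEquality using (_≡_; _≢_)

record Graph : Set where
  field
    n       : ℕ
    adj     : Fin n → Fin n → Bool
    sym     : ∀ u v → adj u v ≡ adj v u
    irrefl  : ∀ v → adj v v ≡ false

open Graph public

Adj : (G : Graph) → Fin (n G) → Fin (n G) → Set
Adj G u v = adj G u v ≡ true

data ReachIn (G : Graph) (P : Fin (n G) → Set) : Fin (n G) → Fin (n G) → Set where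
  here : ∀ {u} → P u → ReachIn G P u u
  step : ∀ {u w v} → P u → Adj G u w → ReachIn G P w v → ReachIn G P u v

Connected : Graph → Set
Connected G = ∀ u v → ReachIn G (λ _ → ⊤) u v

VSet : Graph → Set
VSet G = Fin (n G) → Bool

_∈S_ : ∀ {G} → Fin (n G) → VSet G → Set
x ∈S S = S x ≡ true

_∉S_ : ∀ {G} → Fin (n G) → VSet G → Set
x ∉S S = S x ≡ false

ReachAvoid : (G : Graph) → VSet G → Fin (n G) → Fin (n G) → Set
ReachAvoid G S = ReachIn G (λ x → _∉S_ {G} x S)

CutSet : (G : Graph) → VSet G → Set
CutSet G S = Σ (Fin (n G)) λ a → Σ (Fin (n G)) λ b →
  _∉S_ {G} a S × _∉S_ {G} b S × ¬ ReachAvoid G S a b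

InG0 : (G : Graph) → VSet G → Fin (n G) → Fin (n G) → Set
InG0 G S r x = _∉S_ {G} x S × ReachAvoid G S r x

OutsideG0S : (G : Graph) → VSet G → Fin (n G) → Fin (n G) → Set
OutsideG0S G S r x = _∉S_ {G} x S × ¬ InG0 G S r x

AtLeastTwo : ∀ {A : Set} → (A → Set) → Set
AtLeastTwo {A} P = Σ A λ a → Σ A λ b → a ≢ b × P a × P b

Config : Graph → Set
Config G = Fin (n G) → ℕ

size : (G : Graph) → Config G → ℕ
size G C = sum (map C (allFin (n G)))

move : (G : Graph) → Config G → Fin (n G) → Fin (n G) → Config G
move G C u v w with w ≟ u
... | yes _ = C u ∸ 2
... | no _ with w ≟ v
...   | yes _ = suc (C v)
...   | no _  = C w

CanMove : (G : Graph) → Config G → Fin (n G) → Fin (n G) → Set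
CanMove G C u v = Adj G u v × 2 ≤ C u

-- Positions of the Two-Player Pebbling Game with root r, and the set of
-- positions from which Defender has a winning strategy (defined inductively;
-- the game is finite since each move reduces the number of pebbles by one).
--   DefWinM C      : Mover is to move on configuration C.
--   DefWinD C u v  : Defender is to move on C, Mover having just pebbled u → v
--                    (so Defender may not pebble v → u).
-- Defender wins if the root has no pebble and no pebbling move exists; Mover
-- wins as soon as the root carries a pebble.  If Defender has no legal move
-- (only the forbidden reverse move being available) the round ends and Mover
-- moves again.
mutual
  data DefWinM (G : Graph) (r : Fin (n G)) (C : Config G) : Set where
    mover-turn : C r ≡ 0 →
                 (∀ u v → CanMove G C u v → DefWinD G r (move G C u v) u v) →
                 DefWinM G r C

  data DefWinD (G : Graph) (r : Fin (n G)) (C : Config G) (u v : Fin (n G)) : Set where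
    respond : C r ≡ 0 → ∀ a b → CanMove G C a b → ¬ (a ≡ v × b ≡ u) →
              DefWinM G r (move G C a b) → DefWinD G r C u v
    stuck   : C r ≡ 0 →
              (∀ a b → CanMove G C a b → a ≡ v × b ≡ u) →
              DefWinM G r C → DefWinD G r C u v

DefenderWins : (G : Graph) → Fin (n G) → Config G → Set
DefenderWins = DefWinM

EtaInfinite : (G : Graph) → Fin (n G) → Set
EtaInfinite G r = ∀ (m : ℕ) → Σ (Config G) λ C → m < size G C × DefenderWins G r C

module Submission where

-- Proof idea (a Defender strategy that keeps G₀ empty forever).
-- Call a configuration *safe* if no pebble lies in G₀ (the component of
-- G - S containing r) and every vertex of S carries at most one pebble.
-- In a safe configuration only vertices outside G₀ ∪ S can be pebbled from,
-- so the root stays empty, and Defender can always answer so as to restore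
-- safety:
--   * if Mover pushes a second pebble onto some v ∈ S, Defender relays the
--     pair onward to a neighbour of v outside G₀ ∪ S other than Mover's source
--     (first hypothesis);
--   * otherwise Defender plays any allowed move, redirecting it away from S
--     (second hypothesis) whenever it would land in S.
-- Since every move removes one pebble, the game is finite and this strategy
-- wins.  A cut set is nonempty in a connected graph, so a vertex v ∈ S and a
-- neighbour w of v outside G₀ ∪ S exist; any pile of pebbles on w is safe,
-- hence η(G,r) = ∞.

open import Defs hiding (sym)
open import Data.Fin using (Fin; zero; suc)
open import Data.Fin.Properties using (_≟_; any?; punchInᵢ≢i)
open import Data.Nat using (ℕ; zero; suc; _+_; _∸_; _≤_; _<_; z≤n; s≤s; _≤?_)
open import Data.Nat.Properties
  using (+-0-commutativeMonoid; +-comm; +-identityʳ; suc-injective; m∸n+n≡m;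
         m∸n≤m; <-irrefl; n≮0; ≤-refl; ≤-reflexive; ≤-trans; <-trans; <-≤-trans;
         n≤0⇒n≡0; n≤1⇒n≡0∨n≡1)
open import Data.Bool using (Bool; true; false)
import Data.Bool.Properties as Bool
open import Data.List using (tabulate)
open import Data.List.Properties using (map-tabulate)
import Data.Nat.ListAction as List
open import Data.Vec.Functional using (Vector; removeAt)
open import Algebra.Properties.CommutativeMonoid.Sum +-0-commutativeMonoid
  using (sum-remove; ∑-distrib-+; sum-cong-≗; sum-replicate-zero)
  renaming (sum to ∑)
open import Data.Product using (Σ; _×_; _,_; proj₁; proj₂)
open import Data.Sum using (_⊎_; inj₁; inj₂)
open import Data.Unit using (⊤)
open import Data.Empty using (⊥; ⊥-elim)
open import Relation.Nullary using (¬_; yes; no; Dec)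
open import Relation.Nullary.Decidable using (_×-dec_; ¬?; decidable-stable)
open import Relation.Binary.PropositionalEquality
  using (_≡_; _≢_; refl; sym; trans; cong; cong₂; subst; module ≡-Reasoning)

-- The size of a configuration is the finite sum ∑ of its values, so the
-- library's summation lemmas apply to it.
list-sum-tabulate : ∀ {k} (f : Vector ℕ k) → List.sum (tabulate f) ≡ ∑ f
list-sum-tabulate {zero}  f = refl
list-sum-tabulate {suc k} f = cong (f zero +_) (list-sum-tabulate (λ i → f (suc i)))

size≡∑ : (G : Graph) (C : Config G) → size G C ≡ ∑ C
size≡∑ G C = trans (cong List.sum (map-tabulate (λ i → i) C)) (list-sum-tabulate C)

pile : ∀ {k} → Fin k → ℕ → Vector ℕ k
pile w c x with x ≟ w
... | yes _ = c
... | no _  = 0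

pile-here : ∀ {k} (w : Fin k) c → pile w c w ≡ c
pile-here w c with w ≟ w
... | yes _   = refl
... | no w≢w = ⊥-elim (w≢w refl)

pile-elsewhere : ∀ {k} {w x : Fin k} c → x ≢ w → pile w c x ≡ 0
pile-elsewhere {w = w} {x} c x≢w with x ≟ w
... | yes x≡w = ⊥-elim (x≢w x≡w)
... | no _    = refl

∑-pile : ∀ {k} (w : Fin k) c → ∑ (pile w c) ≡ c
∑-pile {suc k} w c = begin
  ∑ (pile w c)                           ≡⟨ sum-remove {i = w} (pile w c) ⟩
  pile w c w + ∑ (removeAt (pile w c) w) ≡⟨ cong₂ _+_ (pile-here w c) off-w ⟩
  c + ∑ {k} (λ _ → 0)                    ≡⟨ cong (c +_) (sum-replicate-zero k) ⟩
  c + 0                                  ≡⟨ +-identityʳ c ⟩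
  c                                      ∎
  where
  open ≡-Reasoning
  off-w : ∑ (removeAt (pile w c) w) ≡ ∑ {k} (λ _ → 0)
  off-w = sum-cong-≗ {k} (λ j → pile-elsewhere c (punchInᵢ≢i w j))

adj⇒≢ : ∀ G {u v} → Adj G u v → u ≢ v
adj⇒≢ G {u} u~v refl with trans (sym u~v) (irrefl G u)
... | ()

move-source : ∀ G C a b → move G C a b a ≡ C a ∸ 2
move-source G C a b with a ≟ a
... | yes _   = refl
... | no a≢a = ⊥-elim (a≢a refl)

move-target : ∀ G C a b → a ≢ b → move G C a b b ≡ suc (C b)
move-target G C a b a≢b with b ≟ a
... | yes b≡a = ⊥-elim (a≢b (sym b≡a))
... | no _ with b ≟ b
...   | yes _   = refl
...   | no b≢b = ⊥-elim (b≢b refl)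

move-elsewhere : ∀ G C a b x → x ≢ a → x ≢ b → move G C a b x ≡ C x
move-elsewhere G C a b x x≢a x≢b with x ≟ a
... | yes x≡a = ⊥-elim (x≢a x≡a)
... | no _ with x ≟ b
...   | yes x≡b = ⊥-elim (x≢b x≡b)
...   | no _    = refl

move-dominated : ∀ G C a b x → x ≢ b → move G C a b x ≤ C x
move-dominated G C a b x x≢b = cases (x ≟ a)
  where
  cases : Dec (x ≡ a) → move G C a b x ≤ C x
  cases (yes x≡a) = subst (λ y → move G C a b y ≤ C y) (sym x≡a)
                      (≤-trans (≤-reflexive (move-source G C a b)) (m∸n≤m (C a) 2))
  cases (no x≢a)  = ≤-reflexive (move-elsewhere G C a b x x≢a x≢b)

move-balance : ∀ G C a b → a ≢ b → 2 ≤ C a → ∀ x →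
  move G C a b x + (pile a 1 x + pile a 1 x) ≡ C x + pile b 1 x
move-balance G C a b a≢b 2≤Ca x = cases x (x ≟ a) (x ≟ b)
  where
  open ≡-Reasoning
  doubled : ∀ {m c} → m ≡ c → m + m ≡ c + c
  doubled m≡c = cong₂ _+_ m≡c m≡c
  cases : ∀ x → Dec (x ≡ a) → Dec (x ≡ b) →
    move G C a b x + (pile a 1 x + pile a 1 x) ≡ C x + pile b 1 x
  cases x (yes refl) _ = begin
    move G C a b a + (pile a 1 a + pile a 1 a)
      ≡⟨ cong₂ _+_ (move-source G C a b) (doubled (pile-here a 1)) ⟩
    C a ∸ 2 + 2        ≡⟨ m∸n+n≡m 2≤Ca ⟩
    C a                ≡⟨ sym (+-identityʳ (C a)) ⟩
    C a + 0            ≡⟨ cong (C a +_) (sym (pile-elsewhere 1 a≢b)) ⟩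
    C a + pile b 1 a   ∎
  cases x (no x≢a) (yes refl) = begin
    move G C a b b + (pile a 1 b + pile a 1 b)
      ≡⟨ cong₂ _+_ (move-target G C a b a≢b) (doubled (pile-elsewhere 1 x≢a)) ⟩
    suc (C b) + 0      ≡⟨ +-identityʳ (suc (C b)) ⟩
    suc (C b)          ≡⟨ +-comm 1 (C b) ⟩
    C b + 1            ≡⟨ cong (C b +_) (sym (pile-here b 1)) ⟩
    C b + pile b 1 b   ∎
  cases x (no x≢a) (no x≢b) = begin
    move G C a b x + (pile a 1 x + pile a 1 x)
      ≡⟨ cong₂ _+_ (move-elsewhere G C a b x x≢a x≢b) (doubled (pile-elsewhere 1 x≢a)) ⟩
    C x + 0            ≡⟨ cong (C x +_) (sym (pile-elsewhere 1 x≢b)) ⟩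
    C x + pile b 1 x   ∎

size-move : ∀ G C a b → CanMove G C a b → suc (size G (move G C a b)) ≡ size G C
size-move G C a b (a~b , 2≤Ca) = suc-injective (begin
  suc (suc (size G M))              ≡⟨ cong (λ s → suc (suc s)) (size≡∑ G M) ⟩
  suc (suc (∑ M))                   ≡⟨ +-comm 2 (∑ M) ⟩
  ∑ M + 2                           ≡⟨ cong (∑ M +_) (sym (cong₂ _+_ (∑-pile a 1) (∑-pile a 1))) ⟩
  ∑ M + (∑ 𝟙a + ∑ 𝟙a)               ≡⟨ cong (∑ M +_) (sym (∑-distrib-+ 𝟙a 𝟙a)) ⟩
  ∑ M + ∑ (λ x → 𝟙a x + 𝟙a x)       ≡⟨ sym (∑-distrib-+ M (λ x → 𝟙a x + 𝟙a x)) ⟩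
  ∑ (λ x → M x + (𝟙a x + 𝟙a x))     ≡⟨ sum-cong-≗ (move-balance G C a b (adj⇒≢ G a~b) 2≤Ca) ⟩
  ∑ (λ x → C x + pile b 1 x)        ≡⟨ ∑-distrib-+ C (pile b 1) ⟩
  ∑ C + ∑ (pile b 1)                ≡⟨ cong (∑ C +_) (∑-pile b 1) ⟩
  ∑ C + 1                           ≡⟨ +-comm (∑ C) 1 ⟩
  suc (∑ C)                         ≡⟨ cong suc (sym (size≡∑ G C)) ⟩
  suc (size G C)                    ∎)
  where
  open ≡-Reasoning
  M = move G C a b
  𝟙a = pile a 1

size-move-< : ∀ G C a b → CanMove G C a b → size G (move G C a b) < size G C
size-move-< G C a b legal = ≤-reflexive (size-move G C a b legal)

adj-sym : ∀ G {u v} → Adj G u v → Adj G v u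
adj-sym G {u} {v} u~v = trans (Graph.sym G v u) u~v

∈∉-absurd : ∀ {b : Bool} → b ≡ true → b ≡ false → ⊥
∈∉-absurd refl ()

∈S-split : ∀ G (S : VSet G) x → _∈S_ {G} x S ⊎ _∉S_ {G} x S
∈S-split G S x with S x
... | true  = inj₁ refl
... | false = inj₂ refl

walk-snoc : ∀ {G P a x y} → ReachIn G P a x → P y → Adj G x y → ReachIn G P a y
walk-snoc (here Px)          Py x~y = step Px x~y (here Py)
walk-snoc (step Pa a~w rest) Py x~y = step Pa a~w (walk-snoc rest Py x~y)

walk-meets-S : ∀ G (S : VSet G) {a b} → ReachIn G (λ _ → ⊤) a b → _∉S_ {G} a S →
  ReachAvoid G S a b ⊎ Σ (Fin (n G)) λ v → _∈S_ {G} v S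
walk-meets-S G S (here _) a∉S = inj₁ (here a∉S)
walk-meets-S G S (step {w = w} _ a~w rest) a∉S with ∈S-split G S w
... | inj₁ w∈S = inj₂ (w , w∈S)
... | inj₂ w∉S with walk-meets-S G S rest w∉S
...   | inj₁ avoid = inj₁ (step a∉S a~w avoid)
...   | inj₂ hit   = inj₂ hit

pick-other : ∀ {k} {P : Fin k → Set} (u : Fin k) → AtLeastTwo P → Σ (Fin k) λ w → w ≢ u × P w
pick-other u (w₁ , w₂ , w₁≢w₂ , P₁ , P₂) with w₁ ≟ u
... | yes w₁≡u = w₂ , (λ w₂≡u → w₁≢w₂ (trans w₁≡u (sym w₂≡u))) , P₂
... | no w₁≢u  = w₁ , w₁≢u , P₁

module Strategy
  (G : Graph) (r : Fin (n G)) (S : VSet G) (r∉S : _∉S_ {G} r S)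
  (S-escapes : ∀ v → _∈S_ {G} v S → AtLeastTwo (λ w → Adj G v w × OutsideG0S G S r w))
  (boundary-escapes : ∀ x → (Σ (Fin (n G)) λ v → _∈S_ {G} v S × Adj G v x) →
     OutsideG0S G S r x → AtLeastTwo (λ w → Adj G x w × _∉S_ {G} w S))
  where

  G₀ : Fin (n G) → Set
  G₀ = InG0 G S r

  r∈G₀ : G₀ r
  r∈G₀ = r∉S , here r∉S

  G₀-closed : ∀ {x y} → G₀ x → _∉S_ {G} y S → Adj G x y → G₀ y
  G₀-closed (_ , r⇝x) y∉S x~y = y∉S , walk-snoc r⇝x y∉S x~y

  -- The invariant maintained by Defender after each of her moves.
  record Safe (C : Config G) : Set where
    field
      G₀-empty : ∀ x → G₀ x → C x ≡ 0
      S-light  : ∀ x → _∈S_ {G} x S → C x ≤ 1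
  open Safe

  root-empty : ∀ {C} → Safe C → C r ≡ 0
  root-empty safe = G₀-empty safe r r∈G₀

  safe-dominated : ∀ {C D b} → Safe C → (∀ x → x ≢ b → D x ≤ C x) → ¬ G₀ b →
    (_∈S_ {G} b S → D b ≤ 1) → Safe D
  safe-dominated {D = D} {b} safe D≤C b∉G₀ b-light = record
    { G₀-empty = λ x x∈G₀ → n≤0⇒n≡0 (≤-trans (D≤C x (λ { refl → b∉G₀ x∈G₀ }))
                                             (≤-reflexive (G₀-empty safe x x∈G₀)))
    ; S-light  = S-light′
    }
    where
    S-light′ : ∀ x → _∈S_ {G} x S → D x ≤ 1
    S-light′ x x∈S with x ≟ b
    ... | yes refl = b-light x∈S
    ... | no x≢b   = ≤-trans (D≤C x x≢b) (S-light safe x x∈S)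

  loaded-outside : ∀ {C a} → Safe C → 2 ≤ C a → OutsideG0S G S r a
  loaded-outside {C} {a} safe 2≤Ca with ∈S-split G S a
  ... | inj₁ a∈S = ⊥-elim (<-irrefl refl (≤-trans 2≤Ca (S-light safe a a∈S)))
  ... | inj₂ a∉S = a∉S , λ a∈G₀ → n≮0 (subst (2 ≤_) (G₀-empty safe a a∈G₀) 2≤Ca)

  target-outside-G₀ : ∀ {C a b} → Safe C → CanMove G C a b → ¬ G₀ b
  target-outside-G₀ safe (a~b , 2≤Ca) b∈G₀ =
    proj₂ a-out (G₀-closed b∈G₀ (proj₁ a-out) (adj-sym G a~b))
    where a-out = loaded-outside safe 2≤Ca

  safe-move : ∀ {C a b} → Safe C → CanMove G C a b → (_∈S_ {G} b S → C b ≡ 0) →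
    Safe (move G C a b)
  safe-move {C} {a} {b} safe legal b-empty =
    safe-dominated safe (λ x → move-dominated G C a b x) (target-outside-G₀ safe legal)
      (λ b∈S → ≤-reflexive (trans (move-target G C a b (adj⇒≢ G (proj₁ legal)))
                                  (cong suc (b-empty b∈S))))

  safe-relay : ∀ {C u v w} → Safe C → u ≢ v → OutsideG0S G S r w →
    Safe (move G (move G C u v) v w)
  safe-relay {C} {u} {v} {w} safe u≢v (w∉S , w∉G₀) =
    safe-dominated safe dominated w∉G₀ (λ w∈S → ⊥-elim (∈∉-absurd w∈S w∉S))
    where
    C′ = move G C u v
    -- at v the relay removes the two pebbles, one of which Mover had added
    relayed : move G C′ v w v ≤ C v
    relayed = subst (_≤ C v)
                (sym (trans (move-source G C′ v w) (cong (_∸ 2) (move-target G C u v u≢v))))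
                (m∸n≤m (C v) 1)
    dominated : ∀ x → x ≢ w → move G C′ v w x ≤ C x
    dominated x x≢w = cases (x ≟ v)
      where
      cases : Dec (x ≡ v) → move G C′ v w x ≤ C x
      cases (yes x≡v) = subst (λ y → move G C′ v w y ≤ C y) (sym x≡v) relayed
      cases (no x≢v)  = ≤-trans (move-dominated G C′ v w x x≢w) (move-dominated G C u v x x≢v)

  allowed? : ∀ C (u v a b : Fin (n G)) → Dec (CanMove G C a b × ¬ (a ≡ v × b ≡ u))
  allowed? C u v a b =
    ((adj G a b Bool.≟ true) ×-dec (2 ≤? C a)) ×-dec ¬? ((a ≟ v) ×-dec (b ≟ u))

  -- The strategy; k bounds the number of pebbles, so recursion terminates.
  mutual
    moverTurn : ∀ k C → size G C < k → Safe C → DefWinM G r C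
    moverTurn (suc k) C (s≤s size≤k) safe =
      mover-turn (root-empty safe) (λ u v legal → afterMover k C u v size≤k safe legal)

    afterMover : ∀ k C u v → size G C ≤ k → Safe C → CanMove G C u v →
      DefWinD G r (move G C u v) u v
    afterMover k C u v size≤k safe legal with ∈S-split G S v
    ... | inj₂ v∉S = defenderTurn k _ u v (<-≤-trans (size-move-< G C u v legal) size≤k)
                          (safe-move safe legal (λ v∈S → ⊥-elim (∈∉-absurd v∈S v∉S)))
    ... | inj₁ v∈S with n≤1⇒n≡0∨n≡1 (S-light safe v v∈S)
    ...   | inj₁ Cv≡0 = defenderTurn k _ u v (<-≤-trans (size-move-< G C u v legal) size≤k)
                          (safe-move safe legal (λ _ → Cv≡0))
    ...   | inj₂ Cv≡1 = relay k C u v size≤k safe legal v∈S Cv≡1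

    -- v ∈ S now holds two pebbles: Defender passes one on, out of G₀ ∪ S.
    relay : ∀ k C u v → size G C ≤ k → Safe C → CanMove G C u v →
      _∈S_ {G} v S → C v ≡ 1 → DefWinD G r (move G C u v) u v
    relay k C u v size≤k safe legal v∈S Cv≡1 with pick-other u (S-escapes v v∈S)
    ... | w , w≢u , v~w , w-out =
      respond root-empty′ v w legal′ (λ (_ , w≡u) → w≢u w≡u)
        (moverTurn k (move G C′ v w) size″<k (safe-relay safe u≢v w-out))
      where
      u≢v = adj⇒≢ G (proj₁ legal)
      C′ = move G C u v
      r≢v : r ≢ v
      r≢v refl = ∈∉-absurd v∈S r∉S
      root-empty′ : C′ r ≡ 0
      root-empty′ = n≤0⇒n≡0 (≤-trans (move-dominated G C u v r r≢v)
                                     (≤-reflexive (root-empty safe)))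
      legal′ : CanMove G C′ v w
      legal′ = v~w , ≤-reflexive (sym (trans (move-target G C u v u≢v) (cong suc Cv≡1)))
      size″<k : size G (move G C′ v w) < k
      size″<k = <-trans (size-move-< G C′ v w legal′)
                        (<-≤-trans (size-move-< G C u v legal) size≤k)

    defenderTurn : ∀ k C u v → size G C < k → Safe C → DefWinD G r C u v
    defenderTurn k C u v size<k safe with any? (λ a → any? (λ b → allowed? C u v a b))
    ... | no none = stuck (root-empty safe) forced (moverTurn k C size<k safe)
      where
      forced : ∀ a b → CanMove G C a b → a ≡ v × b ≡ u
      forced a b legal = decidable-stable ((a ≟ v) ×-dec (b ≟ u))
                           (λ not-reverse → none (a , b , legal , not-reverse))
    ... | yes (a , b , legal , allowed) with ∈S-split G S b
    ...   | inj₂ b∉S = defenderPlays k C u v size<k safe a b legal allowed b∉S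
    ...   | inj₁ b∈S with pick-other u (boundary-escapes a (b , b∈S , adj-sym G (proj₁ legal))
                                      (loaded-outside safe (proj₂ legal)))
    ...     | w , w≢u , a~w , w∉S =
      defenderPlays k C u v size<k safe a w (a~w , proj₂ legal) (λ (_ , w≡u) → w≢u w≡u) w∉S

    defenderPlays : ∀ k C u v → size G C < k → Safe C → ∀ a b → CanMove G C a b →
      ¬ (a ≡ v × b ≡ u) → _∉S_ {G} b S → DefWinD G r C u v
    defenderPlays k C u v size<k safe a b legal allowed b∉S =
      respond (root-empty safe) a b legal allowed
        (moverTurn k (move G C a b) (<-trans (size-move-< G C a b legal) size<k)
          (safe-move safe legal (λ b∈S → ⊥-elim (∈∉-absurd b∈S b∉S))))

  safe-wins : ∀ {C} → Safe C → DefenderWins G r C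
  safe-wins {C} = moverTurn (suc (size G C)) C ≤-refl

  safe-pile : ∀ {w} c → OutsideG0S G S r w → Safe (pile w c)
  safe-pile {w} c (w∉S , w∉G₀) =
    safe-dominated {C = λ _ → 0} empty (λ x x≢w → ≤-reflexive (pile-elsewhere c x≢w)) w∉G₀
      (λ w∈S → ⊥-elim (∈∉-absurd w∈S w∉S))
    where
    empty : Safe (λ _ → 0)
    empty = record { G₀-empty = λ _ _ → refl ; S-light = λ _ _ → z≤n }

theorem2p4 : (G : Graph) → Connected G → (r : Fin (n G)) → (S : VSet G) →
    CutSet G S → _∉S_ {G} r S →
    (∀ v → _∈S_ {G} v S → AtLeastTwo (λ w → Adj G v w × OutsideG0S G S r w)) →
    (∀ x → (Σ (Fin (n G)) λ v → _∈S_ {G} v S × Adj G v x) → OutsideG0S G S r x →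
      AtLeastTwo (λ w → Adj G x w × _∉S_ {G} w S)) →
    EtaInfinite G r
theorem2p4 G conn r S (a , b , a∉S , _ , a↛b) r∉S S-escapes boundary-escapes m
  with walk-meets-S G S (conn a b) a∉S
... | inj₁ a⇝b = ⊥-elim (a↛b a⇝b)
... | inj₂ (v , v∈S) with S-escapes v v∈S
...   | w , _ , _ , (_ , w-out) , _ =
  pile w (suc m) , m<size , safe-wins (safe-pile (suc m) w-out)
  where
  open Strategy G r S r∉S S-escapes boundary-escapes
  m<size : m < size G (pile w (suc m))
  m<size = ≤-reflexive (sym (trans (size≡∑ G (pile w (suc m))) (∑-pile w (suc m))))
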